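{- Let $h \ge 2$, $v \in V(Q_h)$ and $i \in \{1,\dots,h\}$. Then $L^v_i$ is an outer mutual-visibility set of $Q_h$.
   Context: $Q_h$ is the hypercube with vertex set $\{0,1\}^h$, two strings adjacent iff they differ in exactly one position. $L^v_i$ is the set of vertices at distance exactly $i$ from $v$. For $M \subseteq V(G)$, a $u,v$-path is $M$-free if it contains no vertex of $M\setminus\{u,v\}$; $u,v$ are $M$-visible if there is an $M$-free shortest $u,v$-path. $M$ is an outer mutual-visibility set if every $u,v\in M$ are $M$-visible and every $u \in M$, $v \in V(G)\setminus M$ are $M$-visible. -}

module Defs where

open import Data.Nat using (ℕ; zero; suc; _≤_)
open import Data.Bool using (Bool; true; false)
open import Data.Vec using (Vec; []; _∷_)
open import Data.List using (List; []; _∷_; length)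
open import Data.List.Relation.Unary.All using (All)
open import Data.Product using (Σ; ∃; _×_; _,_)
open import Data.Sum using (_⊎_)
open import Relation.Nullary using (¬_)
open import Relation.Binary.PropositionalEquality using (_≡_)

Vertex : ℕ → Set
Vertex h = Vec Bool h

data Adj : {h : ℕ} → Vertex h → Vertex h → Set where
  here  : ∀ {h} {a b : Bool} {xs : Vertex h} → ¬ (a ≡ b) → Adj (a ∷ xs) (b ∷ xs)
  there : ∀ {h} {a : Bool} {xs ys : Vertex h} → Adj xs ys → Adj (a ∷ xs) (a ∷ ys)

data Walk {h : ℕ} : Vertex h → Vertex h → Set where
  nil  : (u : Vertex h) → Walk u u
  cons : {u w v : Vertex h} → Adj u w → Walk w v → Walk u v

walkLength : ∀ {h} {u v : Vertex h} → Walk u v → ℕ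
walkLength (nil _) = zero
walkLength (cons _ p) = suc (walkLength p)

verts : ∀ {h} {u v : Vertex h} → Walk u v → List (Vertex h)
verts (nil u) = u ∷ []
verts (cons {u = u} _ p) = u ∷ verts p

Dist : ∀ {h} → Vertex h → Vertex h → ℕ → Set
Dist u v n = (Σ (Walk u v) λ p → walkLength p ≡ n)
           × (∀ (q : Walk u v) → n ≤ walkLength q)

-- a shortest u,v-path: a u,v-walk of length d(u,v)
-- (a walk of minimum length is automatically a path)
ShortestPath : ∀ {h} {u v : Vertex h} → Walk u v → Set
ShortestPath {u = u} {v} p = ∀ (q : Walk u v) → walkLength p ≤ walkLength q

Layer : ∀ {h} → Vertex h → ℕ → Vertex h → Set
Layer v i x = Dist v x i

MFree : ∀ {h} (M : Vertex h → Set) {u v : Vertex h} → Walk u v → Set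
MFree M {u} {v} p = All (λ x → x ≡ u ⊎ x ≡ v ⊎ ¬ M x) (verts p)

MVisible : ∀ {h} (M : Vertex h → Set) → Vertex h → Vertex h → Set
MVisible M u v = ∃ λ (p : Walk u v) → ShortestPath p × MFree M p

OuterMutualVisibility : ∀ {h} (M : Vertex h → Set) → Set
OuterMutualVisibility {h} M =
  (∀ (u v : Vertex h) → M u → M v → MVisible M u v)
  × (∀ (u v : Vertex h) → M u → ¬ M v → MVisible M u v)

{-# OPTIONS --safe #-}
-- Distance in Q_h is Hamming distance.  Between any u and x there is a geodesic that first
-- flips, towards v, the coordinates where u disagrees with both v and x, and only then flips
-- the remaining ones away from v; every interior vertex of it is strictly closer to v than u
-- or than x.  This settles two vertices of L^v_i, and u ∈ L^v_i with x closer to v.  When x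
-- is farther from v, use the same geodesic for the antipode of v: distances to the antipode
-- are h minus distances to v, so now every interior vertex is strictly farther from v than i.
module Submission where

open import Defs
open import Data.Nat using (ℕ; suc; _+_; _≤_; _<_; z≤n; s≤s)
open import Data.Nat.Properties
open import Data.Bool using (Bool; true; false; not)
open import Data.Vec using ([]; _∷_; map)
open import Data.List.Relation.Unary.All as All using (All; []; _∷_)
open import Data.Product using (Σ-syntax; _×_; _,_)
open import Data.Sum as Sum using (_⊎_; inj₁; inj₂)
open import Data.Empty using (⊥-elim)
open import Relation.Nullary using (¬_)
open import Relation.Binary using (tri<; tri≈; tri>)
open import Relation.Binary.PropositionalEquality
open import Algebra.Properties.CommutativeSemigroup +-commutativeSemigroup using (interchange)

private
  variable
    h : ℕ
    u v w x y : Vertex h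

diff : Bool → Bool → ℕ
diff false false = 0
diff true  true  = 0
diff _     _     = 1

hamming : Vertex h → Vertex h → ℕ
hamming []       []       = 0
hamming (a ∷ us) (b ∷ xs) = diff a b + hamming us xs

diff-≤-1 : ∀ a b → diff a b ≤ 1
diff-≤-1 false false = z≤n
diff-≤-1 false true  = ≤-refl
diff-≤-1 true  false = ≤-refl
diff-≤-1 true  true  = z≤n

hamming-∷-same : ∀ a (us xs : Vertex h) → hamming (a ∷ us) (a ∷ xs) ≡ hamming us xs
hamming-∷-same false us xs = refl
hamming-∷-same true  us xs = refl

hamming-∷-not : ∀ a (us xs : Vertex h) → hamming (a ∷ us) (not a ∷ xs) ≡ suc (hamming us xs)
hamming-∷-not false us xs = refl
hamming-∷-not true  us xs = refl

hamming-not-∷ : ∀ a (us xs : Vertex h) → hamming (not a ∷ us) (a ∷ xs) ≡ suc (hamming us xs)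
hamming-not-∷ false us xs = refl
hamming-not-∷ true  us xs = refl

hamming-∷-<-flip : ∀ c (vs y : Vertex h) → hamming (c ∷ vs) (c ∷ y) < hamming (c ∷ vs) (not c ∷ y)
hamming-∷-<-flip false vs y = n<1+n (hamming vs y)
hamming-∷-<-flip true  vs y = n<1+n (hamming vs y)

hamming-Adj : Adj u w → hamming u x ≤ suc (hamming w x)
hamming-Adj {u = a ∷ us} {x = c ∷ xs} (here {b = b} _) =
  ≤-trans (+-monoˡ-≤ (hamming us xs) (diff-≤-1 a c)) (s≤s (m≤n+m (hamming us xs) (diff b c)))
hamming-Adj {u = a ∷ us} {w = a ∷ ws} {x = c ∷ xs} (there e) =
  ≤-trans (+-monoʳ-≤ (diff a c) (hamming-Adj e)) (≤-reflexive (+-suc (diff a c) (hamming ws xs)))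

hamming-≤-walkLength : (q : Walk u x) → hamming u x ≤ walkLength q
hamming-≤-walkLength (nil u)    = ≤-reflexive (hamming-refl u)
  where
  hamming-refl : (u : Vertex h) → hamming u u ≡ 0
  hamming-refl []      = refl
  hamming-refl (a ∷ u) = trans (hamming-∷-same a u u) (hamming-refl u)
hamming-≤-walkLength (cons e q) = ≤-trans (hamming-Adj e) (s≤s (hamming-≤-walkLength q))

Adj-flip : ∀ a (xs : Vertex h) → Adj (a ∷ xs) (not a ∷ xs)
Adj-flip false xs = here λ ()
Adj-flip true  xs = here λ ()

Adj-unflip : ∀ a (xs : Vertex h) → Adj (not a ∷ xs) (a ∷ xs)
Adj-unflip false xs = here λ ()
Adj-unflip true  xs = here λ ()

lift : ∀ a → Walk u x → Walk (a ∷ u) (a ∷ x)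
lift a (nil u)    = nil (a ∷ u)
lift a (cons e p) = cons (there e) (lift a p)

walkLength-lift : ∀ a (p : Walk u x) → walkLength (lift a p) ≡ walkLength p
walkLength-lift a (nil u)    = refl
walkLength-lift a (cons e p) = cong suc (walkLength-lift a p)

All-lift : ∀ {P : Vertex (suc h) → Set} a (p : Walk u x) →
           All (λ y → P (a ∷ y)) (verts p) → All P (verts (lift a p))
All-lift a (nil u)    (pu ∷ [])  = pu ∷ []
All-lift a (cons e p) (pu ∷ ps) = pu ∷ All-lift a p ps

snoc : Walk u w → Adj w x → Walk u x
snoc (nil u)    e = cons e (nil _)
snoc (cons d p) e = cons d (snoc p e)

walkLength-snoc : (p : Walk u w) (e : Adj w x) → walkLength (snoc p e) ≡ suc (walkLength p)
walkLength-snoc (nil u)    e = refl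
walkLength-snoc (cons d p) e = cong suc (walkLength-snoc p e)

All-snoc : ∀ {P : Vertex h → Set} (p : Walk u w) (e : Adj w x) →
           All P (verts p) → P x → All P (verts (snoc p e))
All-snoc (nil u)    e (pu ∷ []) px = pu ∷ px ∷ []
All-snoc (cons d p) e (pu ∷ ps) px = pu ∷ All-snoc p e ps px

EndpointOr : Vertex h → Vertex h → (Vertex h → Set) → Vertex h → Set
EndpointOr u x P y = y ≡ u ⊎ y ≡ x ⊎ P y

GeodesicWithin : (Vertex h → Set) → Vertex h → Vertex h → Set
GeodesicWithin P u x =
  Σ[ p ∈ Walk u x ] walkLength p ≡ hamming u x × All (EndpointOr u x P) (verts p)

GeodesicWithin-map : ∀ {P Q : Vertex h → Set} → (∀ {y} → P y → Q y) →
                     GeodesicWithin P u x → GeodesicWithin Q u x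
GeodesicWithin-map f (p , len , inP) = p , len , All.map (Sum.map₂ (Sum.map₂ f)) inP

geodesic-shortest : (p : Walk u x) → walkLength p ≡ hamming u x → ShortestPath p
geodesic-shortest p len q = subst (_≤ walkLength q) (sym len) (hamming-≤-walkLength q)

GeodesicWithin⇒MVisible : ∀ {P} (M : Vertex h → Set) → (∀ {y} → P y → ¬ M y) →
                          GeodesicWithin P u x → MVisible M u x
GeodesicWithin⇒MVisible M avoids g with GeodesicWithin-map avoids g
... | p , len , free = p , geodesic-shortest p len , free

Closer : Vertex h → Vertex h → Vertex h → Vertex h → Set
Closer v u x y = hamming v y < hamming v u ⊎ hamming v y < hamming v x

Farther : Vertex h → Vertex h → Vertex h → Vertex h → Set
Farther v u x y = hamming v u < hamming v y ⊎ hamming v x < hamming v y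

Valley : Vertex h → Vertex h → Vertex h → Set
Valley v u x = GeodesicWithin (Closer v u x) u x

module _ {vs us xs : Vertex h} where

  valley-same-head : ∀ c a → Valley vs us xs → Valley (c ∷ vs) (a ∷ us) (a ∷ xs)
  valley-same-head c a (p , len , inP) =
    lift a p ,
    trans (walkLength-lift a p) (trans len (sym (hamming-∷-same a us xs))) ,
    All-lift a p (All.map step inP)
    where
    step : EndpointOr us xs (Closer vs us xs) y →
           EndpointOr (a ∷ us) (a ∷ xs) (Closer (c ∷ vs) (a ∷ us) (a ∷ xs)) (a ∷ y)
    step = Sum.map (cong (a ∷_)) (Sum.map (cong (a ∷_))
             (Sum.map (+-monoʳ-< (diff c a)) (+-monoʳ-< (diff c a))))

  private
    closer-∷ : ∀ {c a} {z : Vertex h} →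
               hamming vs y < hamming vs z → hamming (c ∷ vs) (c ∷ y) < hamming (c ∷ vs) (a ∷ z)
    closer-∷ {y = y} {c} {a} {z} lt =
      subst (_< _) (sym (hamming-∷-same c vs y)) (<-≤-trans lt (m≤n+m (hamming vs z) (diff c a)))

  valley-flip-first : ∀ c → Valley vs us xs → Valley (c ∷ vs) (not c ∷ us) (c ∷ xs)
  valley-flip-first c (p , len , inP) =
    cons (Adj-unflip c us) (lift c p) ,
    trans (cong suc (trans (walkLength-lift c p) len)) (sym (hamming-not-∷ c us xs)) ,
    inj₁ refl ∷ All-lift c p (All.map step inP)
    where
    step : EndpointOr us xs (Closer vs us xs) y →
           EndpointOr (not c ∷ us) (c ∷ xs) (Closer (c ∷ vs) (not c ∷ us) (c ∷ xs)) (c ∷ y)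
    step (inj₁ refl)        = inj₂ (inj₂ (inj₁ (hamming-∷-<-flip c vs us)))
    step (inj₂ (inj₁ refl)) = inj₂ (inj₁ refl)
    step (inj₂ (inj₂ lt))   = inj₂ (inj₂ (Sum.map closer-∷ closer-∷ lt))

  valley-flip-last : ∀ c → Valley vs us xs → Valley (c ∷ vs) (c ∷ us) (not c ∷ xs)
  valley-flip-last c (p , len , inP) =
    snoc (lift c p) (Adj-flip c xs) ,
    trans (walkLength-snoc (lift c p) (Adj-flip c xs))
          (trans (cong suc (trans (walkLength-lift c p) len)) (sym (hamming-∷-not c us xs))) ,
    All-snoc (lift c p) (Adj-flip c xs) (All-lift c p (All.map step inP)) (inj₂ (inj₁ refl))
    where
    step : EndpointOr us xs (Closer vs us xs) y →
           EndpointOr (c ∷ us) (not c ∷ xs) (Closer (c ∷ vs) (c ∷ us) (not c ∷ xs)) (c ∷ y)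
    step (inj₁ refl)        = inj₁ refl
    step (inj₂ (inj₁ refl)) = inj₂ (inj₂ (inj₂ (hamming-∷-<-flip c vs xs)))
    step (inj₂ (inj₂ lt))   = inj₂ (inj₂ (Sum.map closer-∷ closer-∷ lt))

valley : (v u x : Vertex h) → Valley v u x
valley []       []           []           = nil [] , refl , inj₁ refl ∷ []
valley (c ∷ vs) (false ∷ us) (false ∷ xs) = valley-same-head c false (valley vs us xs)
valley (c ∷ vs) (true ∷ us)  (true ∷ xs)  = valley-same-head c true (valley vs us xs)
valley (false ∷ vs) (true ∷ us)  (false ∷ xs) = valley-flip-first false (valley vs us xs)
valley (true ∷ vs)  (false ∷ us) (true ∷ xs)  = valley-flip-first true (valley vs us xs)
valley (false ∷ vs) (false ∷ us) (true ∷ xs)  = valley-flip-last false (valley vs us xs)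
valley (true ∷ vs)  (true ∷ us)  (false ∷ xs) = valley-flip-last true (valley vs us xs)

antipode : Vertex h → Vertex h
antipode = map not

hamming-antipode : (v y : Vertex h) → hamming v y + hamming (antipode v) y ≡ h
hamming-antipode []       []       = refl
hamming-antipode (c ∷ vs) (a ∷ ys) = begin
  (diff c a + hamming vs ys) + (diff (not c) a + hamming (antipode vs) ys)
    ≡⟨ interchange (diff c a) (hamming vs ys) (diff (not c) a) (hamming (antipode vs) ys) ⟩
  (diff c a + diff (not c) a) + (hamming vs ys + hamming (antipode vs) ys)
    ≡⟨ cong₂ _+_ (diff-not c a) (hamming-antipode vs ys) ⟩
  suc _ ∎
  where
  open ≡-Reasoning
  diff-not : ∀ c a → diff c a + diff (not c) a ≡ 1
  diff-not false false = refl
  diff-not false true  = refl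
  diff-not true  false = refl
  diff-not true  true  = refl

antipode-reverses-< : hamming (antipode v) y < hamming (antipode v) u → hamming v u < hamming v y
antipode-reverses-< {v = v} {y} {u} lt = ≰⇒> λ vy≤vu →
  <-irrefl (trans (hamming-antipode v y) (sym (hamming-antipode v u))) (+-mono-≤-< vy≤vu lt)

ridge : (v u x : Vertex h) → GeodesicWithin (Farther v u x) u x
ridge v u x = GeodesicWithin-map (Sum.map (antipode-reverses-< {v = v}) (antipode-reverses-< {v = v}))
  (valley (antipode v) u x)

Dist-hamming : (u x : Vertex h) → Dist u x (hamming u x)
Dist-hamming u x with valley u u x
... | p , len , _ = (p , len) , hamming-≤-walkLength

Dist-functional : ∀ {m n} → Dist u x m → Dist u x n → m ≡ n
Dist-functional {m = m} {n} ((p , lp) , p-min) ((q , lq) , q-min) =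
  ≤-antisym (subst (m ≤_) lq (p-min q)) (subst (n ≤_) lp (q-min p))

Layer⇒hamming : ∀ {i} → Layer v i y → hamming v y ≡ i
Layer⇒hamming {v = v} {y} = Dist-functional (Dist-hamming v y)

hamming⇒Layer : ∀ {i} → hamming v y ≡ i → Layer v i y
hamming⇒Layer {v = v} {y} eq = subst (Dist v y) eq (Dist-hamming v y)

Closer⇒< : ∀ {k} → Closer v u x y → hamming v u ≤ k → hamming v x ≤ k → hamming v y < k
Closer⇒< (inj₁ lt) u≤k _ = <-≤-trans lt u≤k
Closer⇒< (inj₂ lt) _ x≤k = <-≤-trans lt x≤k

Farther⇒> : ∀ {k} → Farther v u x y → k ≤ hamming v u → k ≤ hamming v x → k < hamming v y
Farther⇒> (inj₁ lt) k≤u _ = ≤-<-trans k≤u lt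
Farther⇒> (inj₂ lt) _ k≤x = ≤-<-trans k≤x lt

proposition3p11 : (h : ℕ) → 2 ≤ h → (v : Vertex h) → (i : ℕ) → 1 ≤ i → i ≤ h →
    OuterMutualVisibility (Layer v i)
proposition3p11 h _ v i _ _ = inner , outer
  where
  M = Layer v i
  below : ∀ {y} → hamming v y < i → ¬ M y
  below lt L = <⇒≢ lt (Layer⇒hamming L)
  above : ∀ {y} → i < hamming v y → ¬ M y
  above lt L = >⇒≢ lt (Layer⇒hamming L)

  inner : ∀ u x → M u → M x → MVisible M u x
  inner u x Lu Lx = GeodesicWithin⇒MVisible M
    (λ c → below (Closer⇒< {v = v} c (≤-reflexive (Layer⇒hamming Lu)) (≤-reflexive (Layer⇒hamming Lx))))
    (valley v u x)

  outer : ∀ u x → M u → ¬ M x → MVisible M u x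
  outer u x Lu ¬Lx with <-cmp (hamming v x) i
  ... | tri≈ _ x≡i _ = ⊥-elim (¬Lx (hamming⇒Layer x≡i))
  ... | tri< x<i _ _ = GeodesicWithin⇒MVisible M
    (λ c → below (Closer⇒< {v = v} c (≤-reflexive (Layer⇒hamming Lu)) (<⇒≤ x<i)))
    (valley v u x)
  ... | tri> _ _ i<x = GeodesicWithin⇒MVisible M
    (λ c → above (Farther⇒> {v = v} c (≤-reflexive (sym (Layer⇒hamming Lu))) (<⇒≤ i<x)))
    (ridge v u x)
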